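{- For every integer $n\ge 6$ with $n\equiv 2\pmod 4$ there exists a $17$-MOFS$(n)$, i.e. a set of $17$ pairwise orthogonal binary frequency squares of order $n$.
   Context: Let $N(n)=\{1,\dots,n\}$ and let $n$ be even. A (binary) frequency square of order $n$ is an $n\times n$ array indexed by $N(n)\times N(n)$ with entries in $\{0,1\}$ such that every row and every column contains exactly $n/2$ zeros and $n/2$ ones. Two frequency squares $F,G$ of order $n$ are orthogonal if for each $(a,b)\in\{0,1\}^2$ the number of cells $(r,c)$ with $(F[r,c],G[r,c])=(a,b)$ equals $n^2/4$. A $k$-MOFS$(n)$ is a set of $k$ pairwise orthogonal frequency squares of order $n$. -}

module Defs where

open import Data.Nat using (ℕ; zero; suc; _+_; _*_; _/_; _%_)
open import Data.Bool using (Bool; true; false; if_then_else_; _∧_)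
open import Data.Fin using (Fin; zero; suc)
open import Data.Product using (_×_)
open import Relation.Binary.PropositionalEquality using (_≡_; _≢_)

count : ∀ {m} → (Fin m → Bool) → ℕ
count {zero}  p = 0
count {suc m} p = (if p zero then 1 else 0) + count (λ i → p (suc i))

-- a binary array of order n (entries in {0,1} encoded as false = 0, true = 1)
Square : ℕ → Set
Square n = Fin n → Fin n → Bool

_==B_ : Bool → Bool → Bool
false ==B false = true
true  ==B true  = true
_     ==B _     = false

rowCount : ∀ {n} → Square n → Fin n → Bool → ℕ
rowCount F r b = count (λ c → F r c ==B b)

colCount : ∀ {n} → Square n → Fin n → Bool → ℕ
colCount F c b = count (λ r → F r c ==B b)

IsFrequencySquare : (n : ℕ) → Square n → Set
IsFrequencySquare n F =
  (∀ r b → rowCount F r b ≡ n / 2) × (∀ c b → colCount F c b ≡ n / 2)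

sumFin : ∀ {m} → (Fin m → ℕ) → ℕ
sumFin {zero}  f = 0
sumFin {suc m} f = f zero + sumFin (λ i → f (suc i))

pairCount : ∀ {n} → Square n → Square n → Bool → Bool → ℕ
pairCount F G a b = sumFin (λ r → count (λ c → (F r c ==B a) ∧ (G r c ==B b)))

Orthogonal : (n : ℕ) → Square n → Square n → Set
Orthogonal n F G = ∀ a b → pairCount F G a b ≡ (n * n) / 4

-- k-MOFS(n): k frequency squares of order n, pairwise orthogonal
-- (indexed by Fin k; distinct indices give orthogonal, hence distinct, squares)
record MOFS (k n : ℕ) : Set where
  field
    square     : Fin k → Square n
    isFreq     : ∀ i → IsFrequencySquare n (square i)
    orthogonal : ∀ i j → i ≢ j → Orthogonal n (square i) (square j)

-- A square S of order n with h symbols of each kind per line is bordered to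
-- [[corner, top], [side, S]] of order n + 4. Line counts and pair counts add blockwise,
-- so orthogonality survives as soon as the border pieces of any two distinct squares
-- contribute (h + 2)² − h² = 4h + 4 cells of each pair type. The borders are grown by
-- prepending a fixed 4 × 4 strip to top and side, which raises that contribution by 8,
-- exactly the increase of 4h + 4. Starting from a 17-MOFS(6), everything therefore
-- rests on three finite families, checked by computation.

module Submission where

open import Algebra.Properties.CommutativeSemigroup using (interchange)
open import Data.Bool using (Bool; true; false; _∧_; if_then_else_)
open import Data.Fin using (Fin; zero; suc; _↑ˡ_; _↑ʳ_; splitAt; _≟_)
open import Data.Fin.Properties using (all?)
open import Data.Nat using (ℕ; zero; suc; _+_; _*_; _/_; _%_; _≤_; s≤s; _≡ᵇ_)
import Data.Nat as ℕ
open import Data.Nat.DivMod using (m*n/n≡m; m≡m%n+[m/n]*n)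
open import Data.Nat.Properties using (+-assoc; +-commutativeSemigroup)
open import Data.Nat.Tactic.RingSolver using (solve-∀)
open import Data.Product using (∃; _,_)
open import Data.Sum using (inj₁; inj₂)
open import Data.Vec using (Vec; []; _∷_; lookup)
open import Data.Vec.Functional using (_++_)
open import Data.Vec.Functional.Properties using (lookup-++ˡ; lookup-++ʳ)
open import Relation.Binary.PropositionalEquality
open import Relation.Nullary using (Dec; ¬?; contradiction)
open import Relation.Nullary.Decidable using (map′; _×-dec_; _→-dec_; from-yes)

open import Defs

private
  variable
    k m n p q r w g h u v : ℕ

count-cong : {f f′ : Fin m → Bool} → (∀ i → f i ≡ f′ i) → count f ≡ count f′
count-cong {zero}  eq = refl
count-cong {suc m} eq =
  cong₂ _+_ (cong (if_then 1 else 0) (eq zero)) (count-cong (λ i → eq (suc i)))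

sumFin-cong : {f f′ : Fin m → ℕ} → (∀ i → f i ≡ f′ i) → sumFin f ≡ sumFin f′
sumFin-cong {zero}  eq = refl
sumFin-cong {suc m} eq = cong₂ _+_ (eq zero) (sumFin-cong (λ i → eq (suc i)))

count-++ : ∀ m (f : Fin (m + n) → Bool) →
           count f ≡ count (λ i → f (i ↑ˡ n)) + count (λ j → f (m ↑ʳ j))
count-++ zero    f = refl
count-++ (suc m) f =
  trans (cong ((if f zero then 1 else 0) +_) (count-++ m (λ i → f (suc i))))
        (sym (+-assoc (if f zero then 1 else 0) _ _))

sumFin-++ : ∀ m (f : Fin (m + n) → ℕ) →
            sumFin f ≡ sumFin (λ i → f (i ↑ˡ n)) + sumFin (λ j → f (m ↑ʳ j))
sumFin-++ zero    f = refl
sumFin-++ (suc m) f =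
  trans (cong (f zero +_) (sumFin-++ m (λ i → f (suc i)))) (sym (+-assoc (f zero) _ _))

sumFin-+ : (f g : Fin m → ℕ) → sumFin (λ i → f i + g i) ≡ sumFin f + sumFin g
sumFin-+ {zero}  f g = refl
sumFin-+ {suc m} f g =
  trans (cong (f zero + g zero +_) (sumFin-+ (λ i → f (suc i)) (λ i → g (suc i))))
        (interchange +-commutativeSemigroup (f zero) (g zero) _ _)

Array : ℕ → ℕ → Set
Array p q = Fin p → Fin q → Bool

hcat : Array p q → Array p r → Array p (q + r)
hcat A B i = A i ++ B i

vcat : Array p r → Array q r → Array (p + q) r
vcat = _++_

RowBalanced : ℕ → Array p q → Set
RowBalanced h A = ∀ i b → count (λ j → A i j ==B b) ≡ h

ColBalanced : ℕ → Array p q → Set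
ColBalanced h A = ∀ j b → count (λ i → A i j ==B b) ≡ h

count-++-∘ : ∀ {X : Set} (x : Fin q → X) (y : Fin r → X) (P : X → Bool) →
            count (λ j → P ((x ++ y) j)) ≡ count (λ j → P (x j)) + count (λ j → P (y j))
count-++-∘ {q} x y P =
  trans (count-++ q (λ j → P ((x ++ y) j)))
        (cong₂ _+_ (count-cong (λ j → cong P (lookup-++ˡ x y j)))
                   (count-cong (λ j → cong P (lookup-++ʳ x y j))))

hcat-rowBalanced : (A : Array p q) (B : Array p r) →
                   RowBalanced u A → RowBalanced v B → RowBalanced (u + v) (hcat A B)
hcat-rowBalanced A B rowA rowB i b =
  trans (count-++-∘ (A i) (B i) (_==B b)) (cong₂ _+_ (rowA i b) (rowB i b))

vcat-colBalanced : (A : Array p r) (C : Array q r) →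
                   ColBalanced u A → ColBalanced v C → ColBalanced (u + v) (vcat A C)
vcat-colBalanced A C colA colC j b =
  trans (count-++-∘ A C (λ x → x j ==B b)) (cong₂ _+_ (colA j b) (colC j b))

hcat-colBalanced : (A : Array p q) (B : Array p r) →
                   ColBalanced h A → ColBalanced h B → ColBalanced h (hcat A B)
hcat-colBalanced {q = q} A B colA colB j b with splitAt q j
... | inj₁ j′ = colA j′ b
... | inj₂ j′ = colB j′ b

vcat-rowBalanced : (A : Array p r) (C : Array q r) →
                   RowBalanced h A → RowBalanced h C → RowBalanced h (vcat A C)
vcat-rowBalanced {p = p} A C rowA rowC i b with splitAt p i
... | inj₁ i′ = rowA i′ b
... | inj₂ i′ = rowC i′ b

rowPairs : (x y : Fin q → Bool) → Bool → Bool → ℕ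
rowPairs x y a b = count (λ j → (x j ==B a) ∧ (y j ==B b))

pairs : Array p q → Array p q → Bool → Bool → ℕ
pairs A B a b = sumFin (λ i → rowPairs (A i) (B i) a b)

rowPairs-++ : ∀ (x x′ : Fin q → Bool) (y y′ : Fin r → Bool) a b →
              rowPairs (x ++ y) (x′ ++ y′) a b ≡ rowPairs x x′ a b + rowPairs y y′ a b
rowPairs-++ {q} x x′ y y′ a b =
  trans (count-++ q (λ j → ((x ++ y) j ==B a) ∧ ((x′ ++ y′) j ==B b)))
        (cong₂ _+_
          (count-cong (λ j → cong₂ (λ s t → (s ==B a) ∧ (t ==B b)) (lookup-++ˡ x y j) (lookup-++ˡ x′ y′ j)))
          (count-cong (λ j → cong₂ (λ s t → (s ==B a) ∧ (t ==B b)) (lookup-++ʳ x y j) (lookup-++ʳ x′ y′ j))))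

pairs-hcat : ∀ (A A′ : Array p q) (B B′ : Array p r) a b →
             pairs (hcat A B) (hcat A′ B′) a b ≡ pairs A A′ a b + pairs B B′ a b
pairs-hcat A A′ B B′ a b =
  trans (sumFin-cong (λ i → rowPairs-++ (A i) (A′ i) (B i) (B′ i) a b))
        (sumFin-+ (λ i → rowPairs (A i) (A′ i) a b) (λ i → rowPairs (B i) (B′ i) a b))

pairs-vcat : ∀ (A A′ : Array p r) (C C′ : Array q r) a b →
             pairs (vcat A C) (vcat A′ C′) a b ≡ pairs A A′ a b + pairs C C′ a b
pairs-vcat {p} A A′ C C′ a b =
  trans (sumFin-++ p (λ i → rowPairs ((A ++ C) i) ((A′ ++ C′) i) a b))
        (cong₂ _+_
          (sumFin-cong (λ i → cong₂ (λ x y → rowPairs x y a b) (lookup-++ˡ A C i) (lookup-++ˡ A′ C′ i)))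
          (sumFin-cong (λ i → cong₂ (λ x y → rowPairs x y a b) (lookup-++ʳ A C i) (lookup-++ʳ A′ C′ i))))

bordered : Array w w → Array w n → Array n w → Array n n → Array (w + n) (w + n)
bordered Z Y X S = vcat (hcat Z Y) (hcat X S)

bordered-rowBalanced : (Z : Array w w) (Y : Array w n) (X : Array n w) (S : Array n n) →
  RowBalanced g Z → RowBalanced h Y → RowBalanced g X → RowBalanced h S →
  RowBalanced (g + h) (bordered Z Y X S)
bordered-rowBalanced Z Y X S rowZ rowY rowX rowS =
  vcat-rowBalanced (hcat Z Y) (hcat X S) (hcat-rowBalanced Z Y rowZ rowY) (hcat-rowBalanced X S rowX rowS)

bordered-colBalanced : (Z : Array w w) (Y : Array w n) (X : Array n w) (S : Array n n) →
  ColBalanced g Z → ColBalanced g Y → ColBalanced h X → ColBalanced h S →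
  ColBalanced (g + h) (bordered Z Y X S)
bordered-colBalanced Z Y X S colZ colY colX colS =
  vcat-colBalanced (hcat Z Y) (hcat X S) (hcat-colBalanced Z Y colZ colY) (hcat-colBalanced X S colX colS)

pairs-bordered : ∀ (Z Z′ : Array w w) (Y Y′ : Array w n) (X X′ : Array n w) (S S′ : Array n n) a b →
  pairs (bordered Z Y X S) (bordered Z′ Y′ X′ S′) a b
    ≡ (pairs Z Z′ a b + pairs Y Y′ a b) + (pairs X X′ a b + pairs S S′ a b)
pairs-bordered Z Z′ Y Y′ X X′ S S′ a b =
  trans (pairs-vcat (hcat Z Y) (hcat Z′ Y′) (hcat X S) (hcat X′ S′) a b)
        (cong₂ _+_ (pairs-hcat Z Z′ Y Y′ a b) (pairs-hcat X X′ S S′ a b))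

OffDiagonal : (Fin k → Fin k → Bool → Bool → ℕ) → ℕ → Set
OffDiagonal f v = ∀ i j → i ≢ j → ∀ a b → f i j a b ≡ v

record BalancedFamily (k n h : ℕ) : Set where
  field
    square       : Fin k → Array n n
    rowBalanced  : ∀ i → RowBalanced h (square i)
    colBalanced  : ∀ i → ColBalanced h (square i)
    pairs-square : OffDiagonal (λ i j → pairs (square i) (square j)) (h * h)

record Border (k w g n h : ℕ) : Set where
  field
    corner : Fin k → Array w w
    top    : Fin k → Array w n
    side   : Fin k → Array n w
    corner-rowBalanced : ∀ i → RowBalanced g (corner i)
    corner-colBalanced : ∀ i → ColBalanced g (corner i)
    top-rowBalanced    : ∀ i → RowBalanced h (top i)
    top-colBalanced    : ∀ i → ColBalanced g (top i)
    side-rowBalanced   : ∀ i → RowBalanced g (side i)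
    side-colBalanced   : ∀ i → ColBalanced h (side i)
    -- (g + h)² − h²: the border's share of each pair type in two bordered squares
    pairs-border       : OffDiagonal (λ i j a b → pairs (corner i) (corner j) a b
                                         + (pairs (top i) (top j) a b + pairs (side i) (side j) a b))
                                     (g * g + 2 * g * h)

record Strip (k w g : ℕ) : Set where
  field
    top  : Fin k → Array w w
    side : Fin k → Array w w
    top-rowBalanced  : ∀ i → RowBalanced g (top i)
    top-colBalanced  : ∀ i → ColBalanced g (top i)
    side-rowBalanced : ∀ i → RowBalanced g (side i)
    side-colBalanced : ∀ i → ColBalanced g (side i)
    -- the growth of g * g + 2 * g * h when h grows by g
    pairs-strip      : OffDiagonal (λ i j a b → pairs (top i) (top j) a b + pairs (side i) (side j) a b)
                                   (2 * g * g)

extend : BalancedFamily k n h → Border k w g n h → BalancedFamily k (w + n) (g + h)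
extend {k} {n} {h} {w} {g} F B = record
  { square       = square′
  ; rowBalanced  = λ i → bordered-rowBalanced (corner i) (top i) (side i) (square i)
                           (corner-rowBalanced i) (top-rowBalanced i) (side-rowBalanced i) (rowBalanced i)
  ; colBalanced  = λ i → bordered-colBalanced (corner i) (top i) (side i) (square i)
                           (corner-colBalanced i) (top-colBalanced i) (side-colBalanced i) (colBalanced i)
  ; pairs-square = pairs-square′
  }
  where
  open BalancedFamily F
  open Border B

  square′ : Fin k → Array (w + n) (w + n)
  square′ i = bordered (corner i) (top i) (side i) (square i)

  pairs-square′ : OffDiagonal (λ i j → pairs (square′ i) (square′ j)) ((g + h) * (g + h))
  pairs-square′ i j i≢j a b = begin
    pairs (square′ i) (square′ j) a b
      ≡⟨ pairs-bordered (corner i) (corner j) (top i) (top j) (side i) (side j) (square i) (square j) a b ⟩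
    (z + y) + (x + s)   ≡⟨ regroup z y x s ⟩
    (z + (y + x)) + s   ≡⟨ cong₂ _+_ (pairs-border i j i≢j a b) (pairs-square i j i≢j a b) ⟩
    (g * g + 2 * g * h) + h * h  ≡⟨ square-of-sum g h ⟩
    (g + h) * (g + h)   ∎
    where
    open ≡-Reasoning
    z = pairs (corner i) (corner j) a b
    y = pairs (top i) (top j) a b
    x = pairs (side i) (side j) a b
    s = pairs (square i) (square j) a b

    regroup : ∀ z y x s → (z + y) + (x + s) ≡ (z + (y + x)) + s
    regroup = solve-∀

    square-of-sum : ∀ g h → (g * g + 2 * g * h) + h * h ≡ (g + h) * (g + h)
    square-of-sum = solve-∀

widen : Border k w g n h → Strip k w g → Border k w g (w + n) (g + h)
widen {k} {w} {g} {n} {h} B T = record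
  { corner             = corner
  ; top                = top′
  ; side               = side′
  ; corner-rowBalanced = corner-rowBalanced
  ; corner-colBalanced = corner-colBalanced
  ; top-rowBalanced    = λ i → hcat-rowBalanced (T.top i) (top i) (T.top-rowBalanced i) (top-rowBalanced i)
  ; top-colBalanced    = λ i → hcat-colBalanced (T.top i) (top i) (T.top-colBalanced i) (top-colBalanced i)
  ; side-rowBalanced   = λ i → vcat-rowBalanced (T.side i) (side i) (T.side-rowBalanced i) (side-rowBalanced i)
  ; side-colBalanced   = λ i → vcat-colBalanced (T.side i) (side i) (T.side-colBalanced i) (side-colBalanced i)
  ; pairs-border       = pairs-border′
  }
  where
  open Border B
  module T = Strip T

  top′ : Fin k → Array w (w + n)
  top′ i = hcat (T.top i) (top i)

  side′ : Fin k → Array (w + n) w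
  side′ i = vcat (T.side i) (side i)

  pairs-border′ : OffDiagonal (λ i j a b → pairs (corner i) (corner j) a b
                                 + (pairs (top′ i) (top′ j) a b + pairs (side′ i) (side′ j) a b))
                              (g * g + 2 * g * (g + h))
  pairs-border′ i j i≢j a b = begin
    z + (pairs (top′ i) (top′ j) a b + pairs (side′ i) (side′ j) a b)
      ≡⟨ cong (z +_) (cong₂ _+_ (pairs-hcat (T.top i) (T.top j) (top i) (top j) a b)
                                (pairs-vcat (T.side i) (T.side j) (side i) (side j) a b)) ⟩
    z + ((t + y) + (s + x))        ≡⟨ regroup z t y s x ⟩
    (t + s) + (z + (y + x))        ≡⟨ cong₂ _+_ (T.pairs-strip i j i≢j a b) (pairs-border i j i≢j a b) ⟩
    2 * g * g + (g * g + 2 * g * h) ≡⟨ expand g h ⟩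
    g * g + 2 * g * (g + h)        ∎
    where
    open ≡-Reasoning
    z = pairs (corner i) (corner j) a b
    t = pairs (T.top i) (T.top j) a b
    y = pairs (top i) (top j) a b
    s = pairs (T.side i) (T.side j) a b
    x = pairs (side i) (side j) a b

    regroup : ∀ z t y s x → z + ((t + y) + (s + x)) ≡ (t + s) + (z + (y + x))
    regroup = solve-∀

    expand : ∀ g h → 2 * g * g + (g * g + 2 * g * h) ≡ g * g + 2 * g * (g + h)
    expand = solve-∀

toMOFS : n ≡ h * 2 → BalancedFamily k n h → MOFS k n
toMOFS {h = h} refl F = record
  { square     = square
  ; isFreq     = λ i → (λ r b → trans (rowBalanced i r b) (sym half))
                     , (λ c b → trans (colBalanced i c b) (sym half))
  ; orthogonal = λ i j i≢j a b → trans (pairs-square i j i≢j a b) (sym quarter)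
  }
  where
  open BalancedFamily F

  half : h * 2 / 2 ≡ h
  half = m*n/n≡m h 2

  quarter : h * 2 * (h * 2) / 4 ≡ h * h
  quarter = trans (cong (_/ 4) (double-squared h)) (m*n/n≡m (h * h) 4)
    where
    double-squared : ∀ h → h * 2 * (h * 2) ≡ h * h * 4
    double-squared = solve-∀

all-Bool? : {P : Bool → Set} → (∀ b → Dec (P b)) → Dec (∀ b → P b)
all-Bool? P? = map′ (λ (pf , pt) → λ { false → pf ; true → pt }) (λ ∀P → ∀P false , ∀P true)
                    (P? false ×-dec P? true)

rowBalanced? : ∀ h (A : Array p q) → Dec (RowBalanced h A)
rowBalanced? h A = all? λ i → all-Bool? λ b → count (λ j → A i j ==B b) ℕ.≟ h

colBalanced? : ∀ h (A : Array p q) → Dec (ColBalanced h A)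
colBalanced? h A = all? λ j → all-Bool? λ b → count (λ i → A i j ==B b) ℕ.≟ h

offDiagonal? : ∀ (f : Fin k → Fin k → Bool → Bool → ℕ) v → Dec (OffDiagonal f v)
offDiagonal? f v = all? λ i → all? λ j → ¬? (i ≟ j) →-dec all-Bool? λ a → all-Bool? λ b → f i j a b ℕ.≟ v

fromBits : Vec (Vec (Vec ℕ q) p) k → Fin k → Array p q
fromBits t i r c = lookup (lookup (lookup t i) r) c ≡ᵇ 1

squares6Bits : Vec (Vec (Vec ℕ 6) 6) 17
squares6Bits =
    ((0 ∷ 0 ∷ 1 ∷ 0 ∷ 1 ∷ 1 ∷ []) ∷ (0 ∷ 0 ∷ 1 ∷ 1 ∷ 0 ∷ 1 ∷ []) ∷ (0 ∷ 0 ∷ 0 ∷ 1 ∷ 1 ∷ 1 ∷ []) ∷ (1 ∷ 1 ∷ 0 ∷ 1 ∷ 0 ∷ 0 ∷ []) ∷ (1 ∷ 1 ∷ 0 ∷ 0 ∷ 1 ∷ 0 ∷ []) ∷ (1 ∷ 1 ∷ 1 ∷ 0 ∷ 0 ∷ 0 ∷ []) ∷ [])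
  ∷ ((0 ∷ 0 ∷ 1 ∷ 1 ∷ 0 ∷ 1 ∷ []) ∷ (0 ∷ 0 ∷ 0 ∷ 1 ∷ 1 ∷ 1 ∷ []) ∷ (1 ∷ 1 ∷ 1 ∷ 0 ∷ 0 ∷ 0 ∷ []) ∷ (0 ∷ 0 ∷ 1 ∷ 0 ∷ 1 ∷ 1 ∷ []) ∷ (1 ∷ 1 ∷ 0 ∷ 0 ∷ 1 ∷ 0 ∷ []) ∷ (1 ∷ 1 ∷ 0 ∷ 1 ∷ 0 ∷ 0 ∷ []) ∷ [])
  ∷ ((1 ∷ 1 ∷ 1 ∷ 0 ∷ 0 ∷ 0 ∷ []) ∷ (0 ∷ 1 ∷ 0 ∷ 0 ∷ 1 ∷ 1 ∷ []) ∷ (1 ∷ 0 ∷ 0 ∷ 1 ∷ 0 ∷ 1 ∷ []) ∷ (0 ∷ 0 ∷ 0 ∷ 1 ∷ 1 ∷ 1 ∷ []) ∷ (0 ∷ 0 ∷ 1 ∷ 1 ∷ 1 ∷ 0 ∷ []) ∷ (1 ∷ 1 ∷ 1 ∷ 0 ∷ 0 ∷ 0 ∷ []) ∷ [])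
  ∷ ((1 ∷ 0 ∷ 0 ∷ 0 ∷ 1 ∷ 1 ∷ []) ∷ (1 ∷ 1 ∷ 0 ∷ 1 ∷ 0 ∷ 0 ∷ []) ∷ (0 ∷ 0 ∷ 1 ∷ 0 ∷ 1 ∷ 1 ∷ []) ∷ (0 ∷ 1 ∷ 1 ∷ 0 ∷ 0 ∷ 1 ∷ []) ∷ (0 ∷ 0 ∷ 1 ∷ 1 ∷ 1 ∷ 0 ∷ []) ∷ (1 ∷ 1 ∷ 0 ∷ 1 ∷ 0 ∷ 0 ∷ []) ∷ [])
  ∷ ((1 ∷ 0 ∷ 0 ∷ 1 ∷ 1 ∷ 0 ∷ []) ∷ (1 ∷ 0 ∷ 1 ∷ 0 ∷ 0 ∷ 1 ∷ []) ∷ (0 ∷ 1 ∷ 1 ∷ 0 ∷ 1 ∷ 0 ∷ []) ∷ (0 ∷ 0 ∷ 0 ∷ 1 ∷ 1 ∷ 1 ∷ []) ∷ (0 ∷ 1 ∷ 0 ∷ 1 ∷ 0 ∷ 1 ∷ []) ∷ (1 ∷ 1 ∷ 1 ∷ 0 ∷ 0 ∷ 0 ∷ []) ∷ [])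
  ∷ ((0 ∷ 1 ∷ 0 ∷ 1 ∷ 0 ∷ 1 ∷ []) ∷ (0 ∷ 1 ∷ 1 ∷ 0 ∷ 1 ∷ 0 ∷ []) ∷ (0 ∷ 0 ∷ 1 ∷ 0 ∷ 1 ∷ 1 ∷ []) ∷ (1 ∷ 0 ∷ 0 ∷ 1 ∷ 1 ∷ 0 ∷ []) ∷ (1 ∷ 0 ∷ 1 ∷ 0 ∷ 0 ∷ 1 ∷ []) ∷ (1 ∷ 1 ∷ 0 ∷ 1 ∷ 0 ∷ 0 ∷ []) ∷ [])
  ∷ ((0 ∷ 0 ∷ 1 ∷ 0 ∷ 1 ∷ 1 ∷ []) ∷ (1 ∷ 1 ∷ 0 ∷ 0 ∷ 1 ∷ 0 ∷ []) ∷ (0 ∷ 1 ∷ 0 ∷ 1 ∷ 0 ∷ 1 ∷ []) ∷ (1 ∷ 0 ∷ 1 ∷ 0 ∷ 1 ∷ 0 ∷ []) ∷ (0 ∷ 1 ∷ 0 ∷ 1 ∷ 0 ∷ 1 ∷ []) ∷ (1 ∷ 0 ∷ 1 ∷ 1 ∷ 0 ∷ 0 ∷ []) ∷ [])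
  ∷ ((1 ∷ 1 ∷ 0 ∷ 0 ∷ 1 ∷ 0 ∷ []) ∷ (0 ∷ 0 ∷ 0 ∷ 1 ∷ 1 ∷ 1 ∷ []) ∷ (0 ∷ 1 ∷ 0 ∷ 1 ∷ 1 ∷ 0 ∷ []) ∷ (1 ∷ 0 ∷ 1 ∷ 0 ∷ 0 ∷ 1 ∷ []) ∷ (1 ∷ 0 ∷ 1 ∷ 0 ∷ 0 ∷ 1 ∷ []) ∷ (0 ∷ 1 ∷ 1 ∷ 1 ∷ 0 ∷ 0 ∷ []) ∷ [])
  ∷ ((0 ∷ 1 ∷ 1 ∷ 1 ∷ 0 ∷ 0 ∷ []) ∷ (1 ∷ 1 ∷ 0 ∷ 1 ∷ 0 ∷ 0 ∷ []) ∷ (0 ∷ 1 ∷ 0 ∷ 0 ∷ 1 ∷ 1 ∷ []) ∷ (0 ∷ 0 ∷ 1 ∷ 1 ∷ 0 ∷ 1 ∷ []) ∷ (1 ∷ 0 ∷ 0 ∷ 0 ∷ 1 ∷ 1 ∷ []) ∷ (1 ∷ 0 ∷ 1 ∷ 0 ∷ 1 ∷ 0 ∷ []) ∷ [])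
  ∷ ((1 ∷ 1 ∷ 1 ∷ 0 ∷ 0 ∷ 0 ∷ []) ∷ (1 ∷ 0 ∷ 1 ∷ 1 ∷ 0 ∷ 0 ∷ []) ∷ (0 ∷ 0 ∷ 1 ∷ 1 ∷ 0 ∷ 1 ∷ []) ∷ (1 ∷ 0 ∷ 0 ∷ 0 ∷ 1 ∷ 1 ∷ []) ∷ (0 ∷ 1 ∷ 0 ∷ 0 ∷ 1 ∷ 1 ∷ []) ∷ (0 ∷ 1 ∷ 0 ∷ 1 ∷ 1 ∷ 0 ∷ []) ∷ [])
  ∷ ((1 ∷ 0 ∷ 0 ∷ 1 ∷ 0 ∷ 1 ∷ []) ∷ (0 ∷ 1 ∷ 0 ∷ 1 ∷ 0 ∷ 1 ∷ []) ∷ (0 ∷ 1 ∷ 1 ∷ 1 ∷ 0 ∷ 0 ∷ []) ∷ (1 ∷ 1 ∷ 0 ∷ 0 ∷ 1 ∷ 0 ∷ []) ∷ (0 ∷ 0 ∷ 1 ∷ 0 ∷ 1 ∷ 1 ∷ []) ∷ (1 ∷ 0 ∷ 1 ∷ 0 ∷ 1 ∷ 0 ∷ []) ∷ [])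
  ∷ ((1 ∷ 0 ∷ 1 ∷ 0 ∷ 0 ∷ 1 ∷ []) ∷ (0 ∷ 1 ∷ 1 ∷ 0 ∷ 0 ∷ 1 ∷ []) ∷ (1 ∷ 1 ∷ 0 ∷ 0 ∷ 1 ∷ 0 ∷ []) ∷ (1 ∷ 0 ∷ 1 ∷ 1 ∷ 0 ∷ 0 ∷ []) ∷ (0 ∷ 0 ∷ 0 ∷ 1 ∷ 1 ∷ 1 ∷ []) ∷ (0 ∷ 1 ∷ 0 ∷ 1 ∷ 1 ∷ 0 ∷ []) ∷ [])
  ∷ ((0 ∷ 1 ∷ 0 ∷ 1 ∷ 0 ∷ 1 ∷ []) ∷ (1 ∷ 0 ∷ 0 ∷ 1 ∷ 0 ∷ 1 ∷ []) ∷ (1 ∷ 0 ∷ 0 ∷ 0 ∷ 1 ∷ 1 ∷ []) ∷ (1 ∷ 0 ∷ 1 ∷ 0 ∷ 1 ∷ 0 ∷ []) ∷ (0 ∷ 1 ∷ 1 ∷ 1 ∷ 0 ∷ 0 ∷ []) ∷ (0 ∷ 1 ∷ 1 ∷ 0 ∷ 1 ∷ 0 ∷ []) ∷ [])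
  ∷ ((0 ∷ 1 ∷ 1 ∷ 0 ∷ 0 ∷ 1 ∷ []) ∷ (1 ∷ 0 ∷ 1 ∷ 0 ∷ 0 ∷ 1 ∷ []) ∷ (0 ∷ 1 ∷ 0 ∷ 1 ∷ 1 ∷ 0 ∷ []) ∷ (0 ∷ 1 ∷ 0 ∷ 0 ∷ 1 ∷ 1 ∷ []) ∷ (1 ∷ 0 ∷ 1 ∷ 1 ∷ 0 ∷ 0 ∷ []) ∷ (1 ∷ 0 ∷ 0 ∷ 1 ∷ 1 ∷ 0 ∷ []) ∷ [])
  ∷ ((1 ∷ 0 ∷ 0 ∷ 0 ∷ 1 ∷ 1 ∷ []) ∷ (0 ∷ 1 ∷ 1 ∷ 1 ∷ 0 ∷ 0 ∷ []) ∷ (1 ∷ 1 ∷ 0 ∷ 0 ∷ 0 ∷ 1 ∷ []) ∷ (0 ∷ 0 ∷ 0 ∷ 1 ∷ 1 ∷ 1 ∷ []) ∷ (1 ∷ 1 ∷ 1 ∷ 0 ∷ 0 ∷ 0 ∷ []) ∷ (0 ∷ 0 ∷ 1 ∷ 1 ∷ 1 ∷ 0 ∷ []) ∷ [])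
  ∷ ((1 ∷ 0 ∷ 1 ∷ 1 ∷ 0 ∷ 0 ∷ []) ∷ (0 ∷ 1 ∷ 0 ∷ 0 ∷ 1 ∷ 1 ∷ []) ∷ (0 ∷ 0 ∷ 1 ∷ 0 ∷ 1 ∷ 1 ∷ []) ∷ (1 ∷ 1 ∷ 0 ∷ 0 ∷ 0 ∷ 1 ∷ []) ∷ (1 ∷ 1 ∷ 0 ∷ 1 ∷ 0 ∷ 0 ∷ []) ∷ (0 ∷ 0 ∷ 1 ∷ 1 ∷ 1 ∷ 0 ∷ []) ∷ [])
  ∷ ((0 ∷ 0 ∷ 1 ∷ 1 ∷ 1 ∷ 0 ∷ []) ∷ (0 ∷ 0 ∷ 1 ∷ 1 ∷ 1 ∷ 0 ∷ []) ∷ (1 ∷ 1 ∷ 0 ∷ 0 ∷ 0 ∷ 1 ∷ []) ∷ (1 ∷ 1 ∷ 0 ∷ 0 ∷ 0 ∷ 1 ∷ []) ∷ (0 ∷ 0 ∷ 1 ∷ 1 ∷ 0 ∷ 1 ∷ []) ∷ (1 ∷ 1 ∷ 0 ∷ 0 ∷ 1 ∷ 0 ∷ []) ∷ [])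
  ∷ []

corners6Bits : Vec (Vec (Vec ℕ 4) 4) 17
corners6Bits =
    ((1 ∷ 1 ∷ 0 ∷ 0 ∷ []) ∷ (0 ∷ 0 ∷ 1 ∷ 1 ∷ []) ∷ (1 ∷ 1 ∷ 0 ∷ 0 ∷ []) ∷ (0 ∷ 0 ∷ 1 ∷ 1 ∷ []) ∷ [])
  ∷ ((1 ∷ 1 ∷ 0 ∷ 0 ∷ []) ∷ (0 ∷ 0 ∷ 1 ∷ 1 ∷ []) ∷ (0 ∷ 0 ∷ 1 ∷ 1 ∷ []) ∷ (1 ∷ 1 ∷ 0 ∷ 0 ∷ []) ∷ [])
  ∷ ((1 ∷ 0 ∷ 1 ∷ 0 ∷ []) ∷ (0 ∷ 1 ∷ 0 ∷ 1 ∷ []) ∷ (1 ∷ 0 ∷ 1 ∷ 0 ∷ []) ∷ (0 ∷ 1 ∷ 0 ∷ 1 ∷ []) ∷ [])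
  ∷ ((0 ∷ 1 ∷ 0 ∷ 1 ∷ []) ∷ (1 ∷ 0 ∷ 1 ∷ 0 ∷ []) ∷ (1 ∷ 0 ∷ 1 ∷ 0 ∷ []) ∷ (0 ∷ 1 ∷ 0 ∷ 1 ∷ []) ∷ [])
  ∷ ((0 ∷ 1 ∷ 0 ∷ 1 ∷ []) ∷ (1 ∷ 0 ∷ 1 ∷ 0 ∷ []) ∷ (1 ∷ 0 ∷ 1 ∷ 0 ∷ []) ∷ (0 ∷ 1 ∷ 0 ∷ 1 ∷ []) ∷ [])
  ∷ ((0 ∷ 1 ∷ 1 ∷ 0 ∷ []) ∷ (1 ∷ 0 ∷ 0 ∷ 1 ∷ []) ∷ (1 ∷ 0 ∷ 0 ∷ 1 ∷ []) ∷ (0 ∷ 1 ∷ 1 ∷ 0 ∷ []) ∷ [])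
  ∷ ((0 ∷ 1 ∷ 1 ∷ 0 ∷ []) ∷ (1 ∷ 0 ∷ 0 ∷ 1 ∷ []) ∷ (1 ∷ 0 ∷ 0 ∷ 1 ∷ []) ∷ (0 ∷ 1 ∷ 1 ∷ 0 ∷ []) ∷ [])
  ∷ ((1 ∷ 1 ∷ 0 ∷ 0 ∷ []) ∷ (1 ∷ 1 ∷ 0 ∷ 0 ∷ []) ∷ (0 ∷ 0 ∷ 1 ∷ 1 ∷ []) ∷ (0 ∷ 0 ∷ 1 ∷ 1 ∷ []) ∷ [])
  ∷ ((1 ∷ 1 ∷ 0 ∷ 0 ∷ []) ∷ (1 ∷ 1 ∷ 0 ∷ 0 ∷ []) ∷ (0 ∷ 0 ∷ 1 ∷ 1 ∷ []) ∷ (0 ∷ 0 ∷ 1 ∷ 1 ∷ []) ∷ [])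
  ∷ ((1 ∷ 0 ∷ 0 ∷ 1 ∷ []) ∷ (1 ∷ 0 ∷ 0 ∷ 1 ∷ []) ∷ (0 ∷ 1 ∷ 1 ∷ 0 ∷ []) ∷ (0 ∷ 1 ∷ 1 ∷ 0 ∷ []) ∷ [])
  ∷ ((1 ∷ 1 ∷ 0 ∷ 0 ∷ []) ∷ (0 ∷ 0 ∷ 1 ∷ 1 ∷ []) ∷ (1 ∷ 1 ∷ 0 ∷ 0 ∷ []) ∷ (0 ∷ 0 ∷ 1 ∷ 1 ∷ []) ∷ [])
  ∷ ((1 ∷ 0 ∷ 0 ∷ 1 ∷ []) ∷ (0 ∷ 1 ∷ 1 ∷ 0 ∷ []) ∷ (1 ∷ 0 ∷ 0 ∷ 1 ∷ []) ∷ (0 ∷ 1 ∷ 1 ∷ 0 ∷ []) ∷ [])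
  ∷ ((0 ∷ 0 ∷ 1 ∷ 1 ∷ []) ∷ (1 ∷ 1 ∷ 0 ∷ 0 ∷ []) ∷ (1 ∷ 1 ∷ 0 ∷ 0 ∷ []) ∷ (0 ∷ 0 ∷ 1 ∷ 1 ∷ []) ∷ [])
  ∷ ((0 ∷ 0 ∷ 1 ∷ 1 ∷ []) ∷ (0 ∷ 0 ∷ 1 ∷ 1 ∷ []) ∷ (1 ∷ 1 ∷ 0 ∷ 0 ∷ []) ∷ (1 ∷ 1 ∷ 0 ∷ 0 ∷ []) ∷ [])
  ∷ ((1 ∷ 0 ∷ 1 ∷ 0 ∷ []) ∷ (0 ∷ 1 ∷ 0 ∷ 1 ∷ []) ∷ (0 ∷ 1 ∷ 0 ∷ 1 ∷ []) ∷ (1 ∷ 0 ∷ 1 ∷ 0 ∷ []) ∷ [])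
  ∷ ((1 ∷ 0 ∷ 0 ∷ 1 ∷ []) ∷ (1 ∷ 0 ∷ 0 ∷ 1 ∷ []) ∷ (0 ∷ 1 ∷ 1 ∷ 0 ∷ []) ∷ (0 ∷ 1 ∷ 1 ∷ 0 ∷ []) ∷ [])
  ∷ ((0 ∷ 1 ∷ 0 ∷ 1 ∷ []) ∷ (1 ∷ 0 ∷ 1 ∷ 0 ∷ []) ∷ (0 ∷ 1 ∷ 0 ∷ 1 ∷ []) ∷ (1 ∷ 0 ∷ 1 ∷ 0 ∷ []) ∷ [])
  ∷ []

tops6Bits : Vec (Vec (Vec ℕ 6) 4) 17
tops6Bits =
    ((0 ∷ 0 ∷ 1 ∷ 1 ∷ 0 ∷ 1 ∷ []) ∷ (0 ∷ 0 ∷ 1 ∷ 1 ∷ 1 ∷ 0 ∷ []) ∷ (1 ∷ 1 ∷ 0 ∷ 0 ∷ 1 ∷ 0 ∷ []) ∷ (1 ∷ 1 ∷ 0 ∷ 0 ∷ 0 ∷ 1 ∷ []) ∷ [])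
  ∷ ((0 ∷ 1 ∷ 1 ∷ 0 ∷ 0 ∷ 1 ∷ []) ∷ (0 ∷ 1 ∷ 1 ∷ 0 ∷ 1 ∷ 0 ∷ []) ∷ (1 ∷ 0 ∷ 0 ∷ 1 ∷ 1 ∷ 0 ∷ []) ∷ (1 ∷ 0 ∷ 0 ∷ 1 ∷ 0 ∷ 1 ∷ []) ∷ [])
  ∷ ((1 ∷ 0 ∷ 0 ∷ 1 ∷ 0 ∷ 1 ∷ []) ∷ (0 ∷ 1 ∷ 1 ∷ 0 ∷ 0 ∷ 1 ∷ []) ∷ (0 ∷ 1 ∷ 1 ∷ 0 ∷ 1 ∷ 0 ∷ []) ∷ (1 ∷ 0 ∷ 0 ∷ 1 ∷ 1 ∷ 0 ∷ []) ∷ [])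
  ∷ ((0 ∷ 1 ∷ 0 ∷ 1 ∷ 1 ∷ 0 ∷ []) ∷ (1 ∷ 0 ∷ 1 ∷ 0 ∷ 0 ∷ 1 ∷ []) ∷ (0 ∷ 1 ∷ 0 ∷ 1 ∷ 1 ∷ 0 ∷ []) ∷ (1 ∷ 0 ∷ 1 ∷ 0 ∷ 0 ∷ 1 ∷ []) ∷ [])
  ∷ ((1 ∷ 1 ∷ 0 ∷ 0 ∷ 0 ∷ 1 ∷ []) ∷ (0 ∷ 0 ∷ 1 ∷ 1 ∷ 1 ∷ 0 ∷ []) ∷ (1 ∷ 1 ∷ 0 ∷ 0 ∷ 0 ∷ 1 ∷ []) ∷ (0 ∷ 0 ∷ 1 ∷ 1 ∷ 1 ∷ 0 ∷ []) ∷ [])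
  ∷ ((1 ∷ 0 ∷ 1 ∷ 0 ∷ 1 ∷ 0 ∷ []) ∷ (1 ∷ 0 ∷ 1 ∷ 0 ∷ 0 ∷ 1 ∷ []) ∷ (0 ∷ 1 ∷ 0 ∷ 1 ∷ 1 ∷ 0 ∷ []) ∷ (0 ∷ 1 ∷ 0 ∷ 1 ∷ 0 ∷ 1 ∷ []) ∷ [])
  ∷ ((0 ∷ 1 ∷ 0 ∷ 1 ∷ 0 ∷ 1 ∷ []) ∷ (0 ∷ 1 ∷ 0 ∷ 1 ∷ 1 ∷ 0 ∷ []) ∷ (1 ∷ 0 ∷ 1 ∷ 0 ∷ 1 ∷ 0 ∷ []) ∷ (1 ∷ 0 ∷ 1 ∷ 0 ∷ 0 ∷ 1 ∷ []) ∷ [])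
  ∷ ((0 ∷ 0 ∷ 1 ∷ 1 ∷ 1 ∷ 0 ∷ []) ∷ (1 ∷ 1 ∷ 0 ∷ 0 ∷ 1 ∷ 0 ∷ []) ∷ (1 ∷ 1 ∷ 0 ∷ 0 ∷ 0 ∷ 1 ∷ []) ∷ (0 ∷ 0 ∷ 1 ∷ 1 ∷ 0 ∷ 1 ∷ []) ∷ [])
  ∷ ((1 ∷ 1 ∷ 0 ∷ 0 ∷ 1 ∷ 0 ∷ []) ∷ (0 ∷ 0 ∷ 1 ∷ 1 ∷ 1 ∷ 0 ∷ []) ∷ (0 ∷ 0 ∷ 1 ∷ 1 ∷ 0 ∷ 1 ∷ []) ∷ (1 ∷ 1 ∷ 0 ∷ 0 ∷ 0 ∷ 1 ∷ []) ∷ [])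
  ∷ ((1 ∷ 0 ∷ 1 ∷ 0 ∷ 1 ∷ 0 ∷ []) ∷ (0 ∷ 1 ∷ 0 ∷ 1 ∷ 0 ∷ 1 ∷ []) ∷ (0 ∷ 1 ∷ 0 ∷ 1 ∷ 1 ∷ 0 ∷ []) ∷ (1 ∷ 0 ∷ 1 ∷ 0 ∷ 0 ∷ 1 ∷ []) ∷ [])
  ∷ ((0 ∷ 1 ∷ 0 ∷ 1 ∷ 1 ∷ 0 ∷ []) ∷ (1 ∷ 0 ∷ 1 ∷ 0 ∷ 0 ∷ 1 ∷ []) ∷ (0 ∷ 1 ∷ 0 ∷ 1 ∷ 0 ∷ 1 ∷ []) ∷ (1 ∷ 0 ∷ 1 ∷ 0 ∷ 1 ∷ 0 ∷ []) ∷ [])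
  ∷ ((1 ∷ 0 ∷ 0 ∷ 1 ∷ 1 ∷ 0 ∷ []) ∷ (0 ∷ 1 ∷ 1 ∷ 0 ∷ 1 ∷ 0 ∷ []) ∷ (1 ∷ 0 ∷ 0 ∷ 1 ∷ 0 ∷ 1 ∷ []) ∷ (0 ∷ 1 ∷ 1 ∷ 0 ∷ 0 ∷ 1 ∷ []) ∷ [])
  ∷ ((1 ∷ 0 ∷ 0 ∷ 1 ∷ 0 ∷ 1 ∷ []) ∷ (1 ∷ 0 ∷ 0 ∷ 1 ∷ 1 ∷ 0 ∷ []) ∷ (0 ∷ 1 ∷ 1 ∷ 0 ∷ 1 ∷ 0 ∷ []) ∷ (0 ∷ 1 ∷ 1 ∷ 0 ∷ 0 ∷ 1 ∷ []) ∷ [])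
  ∷ ((0 ∷ 0 ∷ 1 ∷ 1 ∷ 1 ∷ 0 ∷ []) ∷ (1 ∷ 1 ∷ 0 ∷ 0 ∷ 1 ∷ 0 ∷ []) ∷ (1 ∷ 1 ∷ 0 ∷ 0 ∷ 0 ∷ 1 ∷ []) ∷ (0 ∷ 0 ∷ 1 ∷ 1 ∷ 0 ∷ 1 ∷ []) ∷ [])
  ∷ ((1 ∷ 1 ∷ 0 ∷ 0 ∷ 1 ∷ 0 ∷ []) ∷ (0 ∷ 0 ∷ 1 ∷ 1 ∷ 0 ∷ 1 ∷ []) ∷ (1 ∷ 1 ∷ 0 ∷ 0 ∷ 1 ∷ 0 ∷ []) ∷ (0 ∷ 0 ∷ 1 ∷ 1 ∷ 0 ∷ 1 ∷ []) ∷ [])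
  ∷ ((1 ∷ 0 ∷ 1 ∷ 0 ∷ 0 ∷ 1 ∷ []) ∷ (0 ∷ 1 ∷ 0 ∷ 1 ∷ 1 ∷ 0 ∷ []) ∷ (0 ∷ 1 ∷ 0 ∷ 1 ∷ 0 ∷ 1 ∷ []) ∷ (1 ∷ 0 ∷ 1 ∷ 0 ∷ 1 ∷ 0 ∷ []) ∷ [])
  ∷ ((0 ∷ 1 ∷ 1 ∷ 0 ∷ 0 ∷ 1 ∷ []) ∷ (1 ∷ 0 ∷ 0 ∷ 1 ∷ 0 ∷ 1 ∷ []) ∷ (1 ∷ 0 ∷ 0 ∷ 1 ∷ 1 ∷ 0 ∷ []) ∷ (0 ∷ 1 ∷ 1 ∷ 0 ∷ 1 ∷ 0 ∷ []) ∷ [])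
  ∷ []

sides6Bits : Vec (Vec (Vec ℕ 4) 6) 17
sides6Bits =
    ((1 ∷ 0 ∷ 1 ∷ 0 ∷ []) ∷ (0 ∷ 1 ∷ 0 ∷ 1 ∷ []) ∷ (1 ∷ 0 ∷ 1 ∷ 0 ∷ []) ∷ (0 ∷ 1 ∷ 0 ∷ 1 ∷ []) ∷ (0 ∷ 0 ∷ 1 ∷ 1 ∷ []) ∷ (1 ∷ 1 ∷ 0 ∷ 0 ∷ []) ∷ [])
  ∷ ((0 ∷ 0 ∷ 1 ∷ 1 ∷ []) ∷ (0 ∷ 0 ∷ 1 ∷ 1 ∷ []) ∷ (1 ∷ 1 ∷ 0 ∷ 0 ∷ []) ∷ (1 ∷ 1 ∷ 0 ∷ 0 ∷ []) ∷ (1 ∷ 1 ∷ 0 ∷ 0 ∷ []) ∷ (0 ∷ 0 ∷ 1 ∷ 1 ∷ []) ∷ [])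
  ∷ ((0 ∷ 1 ∷ 1 ∷ 0 ∷ []) ∷ (1 ∷ 0 ∷ 0 ∷ 1 ∷ []) ∷ (1 ∷ 0 ∷ 0 ∷ 1 ∷ []) ∷ (0 ∷ 1 ∷ 1 ∷ 0 ∷ []) ∷ (1 ∷ 0 ∷ 0 ∷ 1 ∷ []) ∷ (0 ∷ 1 ∷ 1 ∷ 0 ∷ []) ∷ [])
  ∷ ((0 ∷ 1 ∷ 0 ∷ 1 ∷ []) ∷ (0 ∷ 1 ∷ 0 ∷ 1 ∷ []) ∷ (1 ∷ 0 ∷ 1 ∷ 0 ∷ []) ∷ (1 ∷ 0 ∷ 1 ∷ 0 ∷ []) ∷ (0 ∷ 1 ∷ 0 ∷ 1 ∷ []) ∷ (1 ∷ 0 ∷ 1 ∷ 0 ∷ []) ∷ [])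
  ∷ ((0 ∷ 0 ∷ 1 ∷ 1 ∷ []) ∷ (1 ∷ 1 ∷ 0 ∷ 0 ∷ []) ∷ (0 ∷ 0 ∷ 1 ∷ 1 ∷ []) ∷ (1 ∷ 1 ∷ 0 ∷ 0 ∷ []) ∷ (1 ∷ 0 ∷ 1 ∷ 0 ∷ []) ∷ (0 ∷ 1 ∷ 0 ∷ 1 ∷ []) ∷ [])
  ∷ ((0 ∷ 0 ∷ 1 ∷ 1 ∷ []) ∷ (1 ∷ 1 ∷ 0 ∷ 0 ∷ []) ∷ (1 ∷ 1 ∷ 0 ∷ 0 ∷ []) ∷ (0 ∷ 0 ∷ 1 ∷ 1 ∷ []) ∷ (1 ∷ 0 ∷ 1 ∷ 0 ∷ []) ∷ (0 ∷ 1 ∷ 0 ∷ 1 ∷ []) ∷ [])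
  ∷ ((1 ∷ 1 ∷ 0 ∷ 0 ∷ []) ∷ (1 ∷ 1 ∷ 0 ∷ 0 ∷ []) ∷ (0 ∷ 0 ∷ 1 ∷ 1 ∷ []) ∷ (0 ∷ 0 ∷ 1 ∷ 1 ∷ []) ∷ (1 ∷ 1 ∷ 0 ∷ 0 ∷ []) ∷ (0 ∷ 0 ∷ 1 ∷ 1 ∷ []) ∷ [])
  ∷ ((1 ∷ 0 ∷ 0 ∷ 1 ∷ []) ∷ (1 ∷ 0 ∷ 0 ∷ 1 ∷ []) ∷ (0 ∷ 1 ∷ 1 ∷ 0 ∷ []) ∷ (0 ∷ 1 ∷ 1 ∷ 0 ∷ []) ∷ (1 ∷ 0 ∷ 0 ∷ 1 ∷ []) ∷ (0 ∷ 1 ∷ 1 ∷ 0 ∷ []) ∷ [])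
  ∷ ((0 ∷ 1 ∷ 1 ∷ 0 ∷ []) ∷ (1 ∷ 0 ∷ 0 ∷ 1 ∷ []) ∷ (1 ∷ 0 ∷ 0 ∷ 1 ∷ []) ∷ (0 ∷ 1 ∷ 1 ∷ 0 ∷ []) ∷ (0 ∷ 1 ∷ 1 ∷ 0 ∷ []) ∷ (1 ∷ 0 ∷ 0 ∷ 1 ∷ []) ∷ [])
  ∷ ((1 ∷ 1 ∷ 0 ∷ 0 ∷ []) ∷ (0 ∷ 0 ∷ 1 ∷ 1 ∷ []) ∷ (0 ∷ 0 ∷ 1 ∷ 1 ∷ []) ∷ (1 ∷ 1 ∷ 0 ∷ 0 ∷ []) ∷ (1 ∷ 0 ∷ 1 ∷ 0 ∷ []) ∷ (0 ∷ 1 ∷ 0 ∷ 1 ∷ []) ∷ [])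
  ∷ ((1 ∷ 0 ∷ 1 ∷ 0 ∷ []) ∷ (1 ∷ 0 ∷ 1 ∷ 0 ∷ []) ∷ (0 ∷ 1 ∷ 0 ∷ 1 ∷ []) ∷ (0 ∷ 1 ∷ 0 ∷ 1 ∷ []) ∷ (1 ∷ 1 ∷ 0 ∷ 0 ∷ []) ∷ (0 ∷ 0 ∷ 1 ∷ 1 ∷ []) ∷ [])
  ∷ ((0 ∷ 1 ∷ 1 ∷ 0 ∷ []) ∷ (0 ∷ 1 ∷ 1 ∷ 0 ∷ []) ∷ (1 ∷ 0 ∷ 0 ∷ 1 ∷ []) ∷ (1 ∷ 0 ∷ 0 ∷ 1 ∷ []) ∷ (1 ∷ 0 ∷ 0 ∷ 1 ∷ []) ∷ (0 ∷ 1 ∷ 1 ∷ 0 ∷ []) ∷ [])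
  ∷ ((0 ∷ 0 ∷ 1 ∷ 1 ∷ []) ∷ (0 ∷ 0 ∷ 1 ∷ 1 ∷ []) ∷ (1 ∷ 1 ∷ 0 ∷ 0 ∷ []) ∷ (1 ∷ 1 ∷ 0 ∷ 0 ∷ []) ∷ (1 ∷ 1 ∷ 0 ∷ 0 ∷ []) ∷ (0 ∷ 0 ∷ 1 ∷ 1 ∷ []) ∷ [])
  ∷ ((0 ∷ 1 ∷ 1 ∷ 0 ∷ []) ∷ (1 ∷ 0 ∷ 0 ∷ 1 ∷ []) ∷ (1 ∷ 0 ∷ 0 ∷ 1 ∷ []) ∷ (0 ∷ 1 ∷ 1 ∷ 0 ∷ []) ∷ (0 ∷ 1 ∷ 1 ∷ 0 ∷ []) ∷ (1 ∷ 0 ∷ 0 ∷ 1 ∷ []) ∷ [])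
  ∷ ((0 ∷ 0 ∷ 1 ∷ 1 ∷ []) ∷ (1 ∷ 1 ∷ 0 ∷ 0 ∷ []) ∷ (0 ∷ 0 ∷ 1 ∷ 1 ∷ []) ∷ (1 ∷ 1 ∷ 0 ∷ 0 ∷ []) ∷ (0 ∷ 1 ∷ 0 ∷ 1 ∷ []) ∷ (1 ∷ 0 ∷ 1 ∷ 0 ∷ []) ∷ [])
  ∷ ((0 ∷ 0 ∷ 1 ∷ 1 ∷ []) ∷ (1 ∷ 1 ∷ 0 ∷ 0 ∷ []) ∷ (1 ∷ 1 ∷ 0 ∷ 0 ∷ []) ∷ (0 ∷ 0 ∷ 1 ∷ 1 ∷ []) ∷ (0 ∷ 1 ∷ 0 ∷ 1 ∷ []) ∷ (1 ∷ 0 ∷ 1 ∷ 0 ∷ []) ∷ [])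
  ∷ ((0 ∷ 1 ∷ 1 ∷ 0 ∷ []) ∷ (1 ∷ 0 ∷ 0 ∷ 1 ∷ []) ∷ (1 ∷ 0 ∷ 0 ∷ 1 ∷ []) ∷ (0 ∷ 1 ∷ 1 ∷ 0 ∷ []) ∷ (1 ∷ 0 ∷ 0 ∷ 1 ∷ []) ∷ (0 ∷ 1 ∷ 1 ∷ 0 ∷ []) ∷ [])
  ∷ []

stripTopsBits : Vec (Vec (Vec ℕ 4) 4) 17
stripTopsBits =
    ((1 ∷ 0 ∷ 1 ∷ 0 ∷ []) ∷ (0 ∷ 1 ∷ 0 ∷ 1 ∷ []) ∷ (1 ∷ 0 ∷ 1 ∷ 0 ∷ []) ∷ (0 ∷ 1 ∷ 0 ∷ 1 ∷ []) ∷ [])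
  ∷ ((0 ∷ 1 ∷ 0 ∷ 1 ∷ []) ∷ (1 ∷ 0 ∷ 1 ∷ 0 ∷ []) ∷ (0 ∷ 1 ∷ 0 ∷ 1 ∷ []) ∷ (1 ∷ 0 ∷ 1 ∷ 0 ∷ []) ∷ [])
  ∷ ((1 ∷ 1 ∷ 0 ∷ 0 ∷ []) ∷ (0 ∷ 0 ∷ 1 ∷ 1 ∷ []) ∷ (1 ∷ 1 ∷ 0 ∷ 0 ∷ []) ∷ (0 ∷ 0 ∷ 1 ∷ 1 ∷ []) ∷ [])
  ∷ ((0 ∷ 0 ∷ 1 ∷ 1 ∷ []) ∷ (1 ∷ 1 ∷ 0 ∷ 0 ∷ []) ∷ (0 ∷ 0 ∷ 1 ∷ 1 ∷ []) ∷ (1 ∷ 1 ∷ 0 ∷ 0 ∷ []) ∷ [])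
  ∷ ((1 ∷ 0 ∷ 0 ∷ 1 ∷ []) ∷ (0 ∷ 1 ∷ 1 ∷ 0 ∷ []) ∷ (1 ∷ 0 ∷ 0 ∷ 1 ∷ []) ∷ (0 ∷ 1 ∷ 1 ∷ 0 ∷ []) ∷ [])
  ∷ ((0 ∷ 1 ∷ 1 ∷ 0 ∷ []) ∷ (1 ∷ 0 ∷ 0 ∷ 1 ∷ []) ∷ (0 ∷ 1 ∷ 1 ∷ 0 ∷ []) ∷ (1 ∷ 0 ∷ 0 ∷ 1 ∷ []) ∷ [])
  ∷ ((1 ∷ 0 ∷ 1 ∷ 0 ∷ []) ∷ (1 ∷ 0 ∷ 1 ∷ 0 ∷ []) ∷ (0 ∷ 1 ∷ 0 ∷ 1 ∷ []) ∷ (0 ∷ 1 ∷ 0 ∷ 1 ∷ []) ∷ [])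
  ∷ ((0 ∷ 1 ∷ 0 ∷ 1 ∷ []) ∷ (0 ∷ 1 ∷ 0 ∷ 1 ∷ []) ∷ (1 ∷ 0 ∷ 1 ∷ 0 ∷ []) ∷ (1 ∷ 0 ∷ 1 ∷ 0 ∷ []) ∷ [])
  ∷ ((1 ∷ 1 ∷ 0 ∷ 0 ∷ []) ∷ (1 ∷ 1 ∷ 0 ∷ 0 ∷ []) ∷ (0 ∷ 0 ∷ 1 ∷ 1 ∷ []) ∷ (0 ∷ 0 ∷ 1 ∷ 1 ∷ []) ∷ [])
  ∷ ((0 ∷ 0 ∷ 1 ∷ 1 ∷ []) ∷ (0 ∷ 0 ∷ 1 ∷ 1 ∷ []) ∷ (1 ∷ 1 ∷ 0 ∷ 0 ∷ []) ∷ (1 ∷ 1 ∷ 0 ∷ 0 ∷ []) ∷ [])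
  ∷ ((1 ∷ 0 ∷ 0 ∷ 1 ∷ []) ∷ (1 ∷ 0 ∷ 0 ∷ 1 ∷ []) ∷ (0 ∷ 1 ∷ 1 ∷ 0 ∷ []) ∷ (0 ∷ 1 ∷ 1 ∷ 0 ∷ []) ∷ [])
  ∷ ((0 ∷ 1 ∷ 1 ∷ 0 ∷ []) ∷ (0 ∷ 1 ∷ 1 ∷ 0 ∷ []) ∷ (1 ∷ 0 ∷ 0 ∷ 1 ∷ []) ∷ (1 ∷ 0 ∷ 0 ∷ 1 ∷ []) ∷ [])
  ∷ ((1 ∷ 0 ∷ 1 ∷ 0 ∷ []) ∷ (0 ∷ 1 ∷ 0 ∷ 1 ∷ []) ∷ (0 ∷ 1 ∷ 0 ∷ 1 ∷ []) ∷ (1 ∷ 0 ∷ 1 ∷ 0 ∷ []) ∷ [])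
  ∷ ((0 ∷ 1 ∷ 0 ∷ 1 ∷ []) ∷ (1 ∷ 0 ∷ 1 ∷ 0 ∷ []) ∷ (1 ∷ 0 ∷ 1 ∷ 0 ∷ []) ∷ (0 ∷ 1 ∷ 0 ∷ 1 ∷ []) ∷ [])
  ∷ ((1 ∷ 1 ∷ 0 ∷ 0 ∷ []) ∷ (0 ∷ 0 ∷ 1 ∷ 1 ∷ []) ∷ (0 ∷ 0 ∷ 1 ∷ 1 ∷ []) ∷ (1 ∷ 1 ∷ 0 ∷ 0 ∷ []) ∷ [])
  ∷ ((0 ∷ 0 ∷ 1 ∷ 1 ∷ []) ∷ (1 ∷ 1 ∷ 0 ∷ 0 ∷ []) ∷ (1 ∷ 1 ∷ 0 ∷ 0 ∷ []) ∷ (0 ∷ 0 ∷ 1 ∷ 1 ∷ []) ∷ [])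
  ∷ ((1 ∷ 0 ∷ 0 ∷ 1 ∷ []) ∷ (0 ∷ 1 ∷ 1 ∷ 0 ∷ []) ∷ (0 ∷ 1 ∷ 1 ∷ 0 ∷ []) ∷ (1 ∷ 0 ∷ 0 ∷ 1 ∷ []) ∷ [])
  ∷ []

stripSidesBits : Vec (Vec (Vec ℕ 4) 4) 17
stripSidesBits =
    ((1 ∷ 0 ∷ 1 ∷ 0 ∷ []) ∷ (0 ∷ 1 ∷ 0 ∷ 1 ∷ []) ∷ (1 ∷ 0 ∷ 1 ∷ 0 ∷ []) ∷ (0 ∷ 1 ∷ 0 ∷ 1 ∷ []) ∷ [])
  ∷ ((1 ∷ 0 ∷ 1 ∷ 0 ∷ []) ∷ (0 ∷ 1 ∷ 0 ∷ 1 ∷ []) ∷ (1 ∷ 0 ∷ 1 ∷ 0 ∷ []) ∷ (0 ∷ 1 ∷ 0 ∷ 1 ∷ []) ∷ [])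
  ∷ ((1 ∷ 1 ∷ 0 ∷ 0 ∷ []) ∷ (0 ∷ 0 ∷ 1 ∷ 1 ∷ []) ∷ (1 ∷ 1 ∷ 0 ∷ 0 ∷ []) ∷ (0 ∷ 0 ∷ 1 ∷ 1 ∷ []) ∷ [])
  ∷ ((1 ∷ 1 ∷ 0 ∷ 0 ∷ []) ∷ (0 ∷ 0 ∷ 1 ∷ 1 ∷ []) ∷ (1 ∷ 1 ∷ 0 ∷ 0 ∷ []) ∷ (0 ∷ 0 ∷ 1 ∷ 1 ∷ []) ∷ [])
  ∷ ((1 ∷ 0 ∷ 0 ∷ 1 ∷ []) ∷ (0 ∷ 1 ∷ 1 ∷ 0 ∷ []) ∷ (1 ∷ 0 ∷ 0 ∷ 1 ∷ []) ∷ (0 ∷ 1 ∷ 1 ∷ 0 ∷ []) ∷ [])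
  ∷ ((1 ∷ 0 ∷ 0 ∷ 1 ∷ []) ∷ (0 ∷ 1 ∷ 1 ∷ 0 ∷ []) ∷ (1 ∷ 0 ∷ 0 ∷ 1 ∷ []) ∷ (0 ∷ 1 ∷ 1 ∷ 0 ∷ []) ∷ [])
  ∷ ((1 ∷ 0 ∷ 1 ∷ 0 ∷ []) ∷ (1 ∷ 0 ∷ 1 ∷ 0 ∷ []) ∷ (0 ∷ 1 ∷ 0 ∷ 1 ∷ []) ∷ (0 ∷ 1 ∷ 0 ∷ 1 ∷ []) ∷ [])
  ∷ ((1 ∷ 0 ∷ 1 ∷ 0 ∷ []) ∷ (1 ∷ 0 ∷ 1 ∷ 0 ∷ []) ∷ (0 ∷ 1 ∷ 0 ∷ 1 ∷ []) ∷ (0 ∷ 1 ∷ 0 ∷ 1 ∷ []) ∷ [])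
  ∷ ((1 ∷ 1 ∷ 0 ∷ 0 ∷ []) ∷ (1 ∷ 1 ∷ 0 ∷ 0 ∷ []) ∷ (0 ∷ 0 ∷ 1 ∷ 1 ∷ []) ∷ (0 ∷ 0 ∷ 1 ∷ 1 ∷ []) ∷ [])
  ∷ ((1 ∷ 1 ∷ 0 ∷ 0 ∷ []) ∷ (1 ∷ 1 ∷ 0 ∷ 0 ∷ []) ∷ (0 ∷ 0 ∷ 1 ∷ 1 ∷ []) ∷ (0 ∷ 0 ∷ 1 ∷ 1 ∷ []) ∷ [])
  ∷ ((1 ∷ 0 ∷ 0 ∷ 1 ∷ []) ∷ (1 ∷ 0 ∷ 0 ∷ 1 ∷ []) ∷ (0 ∷ 1 ∷ 1 ∷ 0 ∷ []) ∷ (0 ∷ 1 ∷ 1 ∷ 0 ∷ []) ∷ [])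
  ∷ ((1 ∷ 0 ∷ 0 ∷ 1 ∷ []) ∷ (1 ∷ 0 ∷ 0 ∷ 1 ∷ []) ∷ (0 ∷ 1 ∷ 1 ∷ 0 ∷ []) ∷ (0 ∷ 1 ∷ 1 ∷ 0 ∷ []) ∷ [])
  ∷ ((1 ∷ 0 ∷ 1 ∷ 0 ∷ []) ∷ (0 ∷ 1 ∷ 0 ∷ 1 ∷ []) ∷ (0 ∷ 1 ∷ 0 ∷ 1 ∷ []) ∷ (1 ∷ 0 ∷ 1 ∷ 0 ∷ []) ∷ [])
  ∷ ((1 ∷ 0 ∷ 1 ∷ 0 ∷ []) ∷ (0 ∷ 1 ∷ 0 ∷ 1 ∷ []) ∷ (0 ∷ 1 ∷ 0 ∷ 1 ∷ []) ∷ (1 ∷ 0 ∷ 1 ∷ 0 ∷ []) ∷ [])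
  ∷ ((1 ∷ 1 ∷ 0 ∷ 0 ∷ []) ∷ (0 ∷ 0 ∷ 1 ∷ 1 ∷ []) ∷ (0 ∷ 0 ∷ 1 ∷ 1 ∷ []) ∷ (1 ∷ 1 ∷ 0 ∷ 0 ∷ []) ∷ [])
  ∷ ((1 ∷ 1 ∷ 0 ∷ 0 ∷ []) ∷ (0 ∷ 0 ∷ 1 ∷ 1 ∷ []) ∷ (0 ∷ 0 ∷ 1 ∷ 1 ∷ []) ∷ (1 ∷ 1 ∷ 0 ∷ 0 ∷ []) ∷ [])
  ∷ ((1 ∷ 0 ∷ 0 ∷ 1 ∷ []) ∷ (0 ∷ 1 ∷ 1 ∷ 0 ∷ []) ∷ (0 ∷ 1 ∷ 1 ∷ 0 ∷ []) ∷ (1 ∷ 0 ∷ 0 ∷ 1 ∷ []) ∷ [])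
  ∷ []

mofs6 : BalancedFamily 17 6 3
mofs6 = record
  { square       = squares
  ; rowBalanced  = from-yes (all? λ i → rowBalanced? 3 (squares i))
  ; colBalanced  = from-yes (all? λ i → colBalanced? 3 (squares i))
  ; pairs-square = from-yes (offDiagonal? (λ i j → pairs (squares i) (squares j)) 9)
  }
  where
  squares : Fin 17 → Array 6 6
  squares = fromBits squares6Bits

border6 : Border 17 4 2 6 3
border6 = record
  { corner             = corners
  ; top                = tops
  ; side               = sides
  ; corner-rowBalanced = from-yes (all? λ i → rowBalanced? 2 (corners i))
  ; corner-colBalanced = from-yes (all? λ i → colBalanced? 2 (corners i))
  ; top-rowBalanced    = from-yes (all? λ i → rowBalanced? 3 (tops i))
  ; top-colBalanced    = from-yes (all? λ i → colBalanced? 2 (tops i))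
  ; side-rowBalanced   = from-yes (all? λ i → rowBalanced? 2 (sides i))
  ; side-colBalanced   = from-yes (all? λ i → colBalanced? 3 (sides i))
  ; pairs-border       = from-yes (offDiagonal? (λ i j a b → pairs (corners i) (corners j) a b
                                       + (pairs (tops i) (tops j) a b + pairs (sides i) (sides j) a b)) 16)
  }
  where
  corners : Fin 17 → Array 4 4
  corners = fromBits corners6Bits
  tops : Fin 17 → Array 4 6
  tops = fromBits tops6Bits
  sides : Fin 17 → Array 6 4
  sides = fromBits sides6Bits

strip : Strip 17 4 2
strip = record
  { top              = tops
  ; side             = sides
  ; top-rowBalanced  = from-yes (all? λ i → rowBalanced? 2 (tops i))
  ; top-colBalanced  = from-yes (all? λ i → colBalanced? 2 (tops i))
  ; side-rowBalanced = from-yes (all? λ i → rowBalanced? 2 (sides i))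
  ; side-colBalanced = from-yes (all? λ i → colBalanced? 2 (sides i))
  ; pairs-strip      = from-yes (offDiagonal? (λ i j a b → pairs (tops i) (tops j) a b
                                     + pairs (sides i) (sides j) a b) 8)
  }
  where
  tops sides : Fin 17 → Array 4 4
  tops  = fromBits stripTopsBits
  sides = fromBits stripSidesBits

border : ∀ m → Border 17 4 2 (6 + m * 4) (3 + m * 2)
border zero    = border6
border (suc m) = widen (border m) strip

family : ∀ m → BalancedFamily 17 (6 + m * 4) (3 + m * 2)
family zero    = mofs6
family (suc m) = extend (family m) (border m)

%4≡2⇒≡6+m*4 : 6 ≤ n → n % 4 ≡ 2 → ∃ λ m → n ≡ 6 + m * 4
%4≡2⇒≡6+m*4 {n} 6≤n n%4≡2 with n / 4 | m≡m%n+[m/n]*n n 4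
... | zero  | n≡2 rewrite n%4≡2 = contradiction (subst (6 ≤_) n≡2 6≤n) λ { (s≤s (s≤s ())) }
... | suc m | n≡2+[1+m]*4 rewrite n%4≡2 = m , n≡2+[1+m]*4

theorem6p8 : (n : ℕ) → 6 ≤ n → n % 4 ≡ 2 → MOFS 17 n
theorem6p8 n 6≤n n%4≡2 with %4≡2⇒≡6+m*4 6≤n n%4≡2
... | m , refl = toMOFS (order≡2*half m) (family m)
  where
  order≡2*half : ∀ m → 6 + m * 4 ≡ (3 + m * 2) * 2
  order≡2*half = solve-∀
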